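{- Let $\Lambda$ be a ring with identity and $A,B,C,D\in\Lambda$. For every integer $k\ge1$, $\sum_n u_{k+1}^{(n)}z^n=G(w)(Az)\sum_n u_k^{(n)}z^n$ in $\Lambda[[z]]$.
   Context: A walk of length $l\ge0$ is an $(l+1)$-tuple $\alpha=(\alpha_0,\dots,\alpha_l)$ of integers with each $\alpha_i-\alpha_{i-1}\in\{ -1,0,1\}$; it is a walk from $\alpha_0$ to $\alpha_l$. Weights: $w(\alpha)=1$ if $l=0$, else $w(\alpha)=U_1\cdots U_l$ with $U_i=A,B,C$ according as $\alpha_i-\alpha_{i-1}=-1,0,1$; $w^*(\alpha)$ is defined the same way except that $U_i=D$ (instead of $B$) whenever $\alpha_{i-1}=\alpha_i=0$. A walk is standard if $\alpha_i\ge\alpha_l$ for all $i$. $G(w)=\sum w(\alpha)z^{l(\alpha)}$ over all standard walks from $0$ to $0$. For $k\ge1$, $u_k^{(n)}=\sum w^*(\alpha)$ over all standard walks of length $n$ from $k-1$ to $0$. -}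

module Defs where

open import Level using (Level)
open import Algebra.Bundles using (Ring)
open import Data.Nat as ℕ using (ℕ; zero; suc; _∸_)
open import Data.Integer as ℤ using (ℤ; +_; 0ℤ; 1ℤ; _≤?_)
import Data.Integer.Properties as ℤP
open import Data.List as List using (List; []; _∷_; foldr; map; upTo; concatMap; filter)
open import Data.List.Relation.Unary.All as All using (All)
open import Data.Vec as Vec using (Vec; []; _∷_)
open import Data.Product using (_×_; _,_)
open import Relation.Nullary using (Dec; yes; no)
open import Relation.Nullary.Decidable using (_×-dec_)
open import Relation.Binary.PropositionalEquality using (_≡_)

data Step : Set where
  down stay up : Step

δ : Step → ℤ
δ down = ℤ.-[1+ 0 ]
δ stay = 0ℤ
δ up   = 1ℤ

-- A walk of length l starting at a is determined by a ∈ ℤ and its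
-- l steps; positions a = α_0, α_1, …, α_l.
positions : ∀ {l} → ℤ → Vec Step l → List ℤ
positions a []       = a ∷ []
positions a (s ∷ ss) = a ∷ positions (a ℤ.+ δ s) ss

endpoint : ∀ {l} → ℤ → Vec Step l → ℤ
endpoint a []       = a
endpoint a (s ∷ ss) = endpoint (a ℤ.+ δ s) ss

Standard : ∀ {l} → ℤ → Vec Step l → Set
Standard a ss = All (λ p → endpoint a ss ℤ.≤ p) (positions a ss)

StdWalk : ∀ {l} → ℤ → ℤ → Vec Step l → Set
StdWalk a b ss = Standard a ss × endpoint a ss ≡ b

stdWalk? : ∀ {l} (a b : ℤ) (ss : Vec Step l) → Dec (StdWalk a b ss)
stdWalk? a b ss = All.all? (λ p → endpoint a ss ≤? p) (positions a ss)
                  ×-dec (endpoint a ss ℤ.≟ b)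

allSteps : (l : ℕ) → List (Vec Step l)
allSteps zero    = [] ∷ []
allSteps (suc l) = concatMap (λ ss → (down ∷ ss) ∷ (stay ∷ ss) ∷ (up ∷ ss) ∷ []) (allSteps l)

stdWalks : (l : ℕ) → ℤ → ℤ → List (Vec Step l)
stdWalks l a b = filter (stdWalk? a b) (allSteps l)

module Walks {c ℓ : Level} (Λ : Ring c ℓ) (A B C D : Ring.Carrier Λ) where
  open Ring Λ

  Σ : List Carrier → Carrier
  Σ = foldr _+_ 0#

  U : Step → Carrier
  U down = A
  U stay = B
  U up   = C

  w : ∀ {l} → Vec Step l → Carrier
  w []       = 1#
  w (s ∷ ss) = U s * w ss

  U* : ℤ → Step → Carrier
  U* a stay with a ℤ.≟ 0ℤ
  ... | yes _ = D
  ... | no  _ = B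
  U* a s = U s

  w* : ∀ {l} → ℤ → Vec Step l → Carrier
  w* a []       = 1#
  w* a (s ∷ ss) = U* a s * w* (a ℤ.+ δ s) ss

  PS : Set c
  PS = ℕ → Carrier

  -- Cauchy product in Λ[[z]] (z central)
  _⊛_ : PS → PS → PS
  (f ⊛ g) n = Σ (map (λ i → f i * g (n ∸ i)) (upTo (suc n)))

  Az : PS
  Az (suc zero) = A
  Az _          = 0#

  G : PS
  G l = Σ (map w (stdWalks l 0ℤ 0ℤ))

  u : ℕ → ℕ → Carrier
  u k n = Σ (map (w* (+ k ℤ.- 1ℤ)) (stdWalks n (+ k ℤ.- 1ℤ) 0ℤ))

  uSeries : ℕ → PS
  uSeries k n = u k n

-- A standard walk from k to 0 passes through k - 1; cutting it at the first
-- time it reaches k - 1 writes it uniquely as a standard walk from k to k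
-- (which stays at height ≥ k ≥ 1, so it never meets the D-weighted steps at
-- 0 and is a translate of a walk counted by G), a down-step of weight A, and
-- a standard walk from k - 1 to 0.  On generating functions this is the
-- product G(w) · Az · Σ u_k z^n.  Sums over enumerated walks are replaced by
-- a first-step recursion, and the decomposition is proved by induction on the
-- length, simultaneously for every start a ≥ k.
module Submission where

open import Defs
open import Level using (Level)
open import Algebra.Bundles using (Ring)
open import Data.Nat using (ℕ; _≤_; suc)
open import Data.Nat as ℕ using (zero; _∸_)
open import Data.Integer as ℤ using (ℤ; +_; 0ℤ; 1ℤ)
import Data.Integer.Properties as ℤ
open import Data.List using (List; []; _∷_; _++_; map; foldr; concatMap; filter; upTo; applyUpTo)
open import Data.List.Relation.Unary.All using ([]; _∷_)
open import Data.Vec using (Vec; []; _∷_)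
open import Data.Product using (_,_)
open import Data.Bool using (true; false; if_then_else_)
open import Data.Empty using (⊥-elim)
open import Function using (_∘_)
open import Relation.Nullary using (Dec; yes; no; does; ¬_)
open import Relation.Binary.PropositionalEquality as ≡ using (_≡_; _≢_)

module Sums {c ℓ} (Λ : Ring c ℓ) where
  open Ring Λ
  open import Algebra.Properties.CommutativeSemigroup +-commutativeSemigroup using (interchange)
  open import Relation.Binary.Reasoning.Setoid setoid

  ∑ : ∀ {a} {X : Set a} → List X → (X → Carrier) → Carrier
  ∑ xs f = foldr _+_ 0# (map f xs)

  syntax ∑ xs (λ x → e) = ∑[ x ∈ xs ] e

  iverson : ∀ {p} {Q : Set p} → Dec Q → Carrier → Carrier
  iverson d x = if does d then x else 0#

  module _ {p} {Q : Set p} where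

    iverson-yes : Q → (d : Dec Q) (x : Carrier) → iverson d x ≡ x
    iverson-yes q (yes _) x = ≡.refl
    iverson-yes q (no ¬q) x = ⊥-elim (¬q q)

    iverson-no : ¬ Q → (d : Dec Q) (x : Carrier) → iverson d x ≡ 0#
    iverson-no ¬q (yes q) x = ⊥-elim (¬q q)
    iverson-no ¬q (no _)  x = ≡.refl

    iverson-⇔ : ∀ {r} {R : Set r} → (Q → R) → (R → Q) →
                (d : Dec Q) (e : Dec R) (x : Carrier) → iverson d x ≡ iverson e x
    iverson-⇔ f g (yes q) (yes r) x = ≡.refl
    iverson-⇔ f g (yes q) (no ¬r) x = ⊥-elim (¬r (f q))
    iverson-⇔ f g (no ¬q) (yes r) x = ⊥-elim (¬q (g r))
    iverson-⇔ f g (no ¬q) (no ¬r) x = ≡.refl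

    iverson-cong : (d : Dec Q) {x y : Carrier} → x ≈ y → iverson d x ≈ iverson d y
    iverson-cong (yes _) x≈y = x≈y
    iverson-cong (no _)  x≈y = refl

    iverson-*ˡ : (d : Dec Q) (x y : Carrier) → x * iverson d y ≈ iverson d (x * y)
    iverson-*ˡ (yes _) x y = refl
    iverson-*ˡ (no _)  x y = zeroʳ x

    iverson-*ʳ : (d : Dec Q) (x y : Carrier) → iverson d x * y ≈ iverson d (x * y)
    iverson-*ʳ (yes _) x y = refl
    iverson-*ʳ (no _)  x y = zeroˡ y

  module _ {a} {X : Set a} where

    ∑-cong : {f g : X → Carrier} → (∀ x → f x ≈ g x) → ∀ xs → ∑ xs f ≈ ∑ xs g
    ∑-cong f≈g []       = refl
    ∑-cong f≈g (x ∷ xs) = +-cong (f≈g x) (∑-cong f≈g xs)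

    ∑-zero : {f : X → Carrier} → (∀ x → f x ≈ 0#) → ∀ xs → ∑ xs f ≈ 0#
    ∑-zero f≈0 []       = refl
    ∑-zero f≈0 (x ∷ xs) = trans (+-cong (f≈0 x) (∑-zero f≈0 xs)) (+-identityˡ 0#)

    ∑-++ : ∀ (f : X → Carrier) xs ys → ∑ (xs ++ ys) f ≈ ∑ xs f + ∑ ys f
    ∑-++ f []       ys = sym (+-identityˡ _)
    ∑-++ f (x ∷ xs) ys = trans (+-congˡ (∑-++ f xs ys)) (sym (+-assoc _ _ _))

    ∑-+ : ∀ (f g : X → Carrier) xs → ∑[ x ∈ xs ] (f x + g x) ≈ ∑ xs f + ∑ xs g
    ∑-+ f g []       = sym (+-identityˡ 0#)
    ∑-+ f g (x ∷ xs) = trans (+-congˡ (∑-+ f g xs)) (interchange _ _ _ _)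

    ∑-*ˡ : ∀ (k : Carrier) (f : X → Carrier) xs → ∑[ x ∈ xs ] (k * f x) ≈ k * ∑ xs f
    ∑-*ˡ k f []       = sym (zeroʳ k)
    ∑-*ˡ k f (x ∷ xs) = trans (+-congˡ (∑-*ˡ k f xs)) (sym (distribˡ k _ _))

    ∑-filter : ∀ {p} {Q : X → Set p} (Q? : ∀ x → Dec (Q x)) (f : X → Carrier) xs →
               ∑ (filter Q? xs) f ≈ ∑[ x ∈ xs ] iverson (Q? x) (f x)
    ∑-filter Q? f []       = refl
    ∑-filter Q? f (x ∷ xs) with does (Q? x)
    ... | true  = +-congˡ (∑-filter Q? f xs)
    ... | false = trans (∑-filter Q? f xs) (sym (+-identityˡ _))


  ∑-concatMap : ∀ {a b} {X : Set a} {Y : Set b} (f : Y → Carrier) (h : X → List Y) xs →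
                ∑ (concatMap h xs) f ≈ ∑[ x ∈ xs ] ∑ (h x) f
  ∑-concatMap f h []       = refl
  ∑-concatMap f h (x ∷ xs) = trans (∑-++ f (h x) (concatMap h xs)) (+-congˡ (∑-concatMap f h xs))

  ∑-steps : (Step → Carrier) → Carrier
  ∑-steps f = f down + (f stay + f up)

  ∑-steps-cong : {f g : Step → Carrier} → (∀ s → f s ≈ g s) → ∑-steps f ≈ ∑-steps g
  ∑-steps-cong f≈g = +-cong (f≈g down) (+-cong (f≈g stay) (f≈g up))

  ∑-steps-zero : {f : Step → Carrier} → (∀ s → f s ≈ 0#) → ∑-steps f ≈ 0#
  ∑-steps-zero f≈0 =
    trans (∑-steps-cong f≈0) (trans (+-congˡ (+-identityˡ 0#)) (+-identityˡ 0#))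

  ∑-steps-*ʳ : ∀ (f : Step → Carrier) x → ∑-steps f * x ≈ ∑-steps (λ s → f s * x)
  ∑-steps-*ʳ f x = trans (distribʳ x _ _) (+-congˡ (distribʳ x _ _))

  ∑-∑-steps : ∀ {a} {X : Set a} (f : X → Step → Carrier) xs →
              ∑[ x ∈ xs ] ∑-steps (f x) ≈ ∑-steps (λ s → ∑[ x ∈ xs ] f x s)
  ∑-∑-steps f xs = trans (∑-+ _ _ xs) (+-congˡ (∑-+ _ _ xs))

  ∑-allSteps-suc : ∀ l (f : Vec Step (suc l) → Carrier) →
                   ∑ (allSteps (suc l)) f ≈ ∑-steps (λ s → ∑[ ss ∈ allSteps l ] f (s ∷ ss))
  ∑-allSteps-suc l f = begin
    ∑ (allSteps (suc l)) f
      ≈⟨ ∑-concatMap f _ (allSteps l) ⟩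
    ∑[ ss ∈ allSteps l ] (f (down ∷ ss) + (f (stay ∷ ss) + (f (up ∷ ss) + 0#)))
      ≈⟨ ∑-cong (λ ss → +-congˡ (+-congˡ (+-identityʳ _))) (allSteps l) ⟩
    ∑[ ss ∈ allSteps l ] ∑-steps (λ s → f (s ∷ ss))
      ≈⟨ ∑-∑-steps (λ ss s → f (s ∷ ss)) (allSteps l) ⟩
    ∑-steps (λ s → ∑[ ss ∈ allSteps l ] f (s ∷ ss)) ∎

-- The Cauchy product _⊛_ in a form suited to induction on the degree.
module Convolution {c ℓ} (Λ : Ring c ℓ) where
  open Ring Λ
  open Sums Λ
  open import Algebra.Properties.CommutativeSemigroup +-commutativeSemigroup using (interchange)

  conv : (ℕ → Carrier) → (ℕ → Carrier) → ℕ → Carrier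
  conv f g zero    = f 0 * g 0
  conv f g (suc n) = f 0 * g (suc n) + conv (f ∘ suc) g n

  map-applyUpTo : ∀ {a} {X : Set a} (F : X → Carrier) (t : ℕ → X) n →
                  map F (applyUpTo t n) ≡ applyUpTo (F ∘ t) n
  map-applyUpTo F t zero    = ≡.refl
  map-applyUpTo F t (suc n) = ≡.cong (F (t 0) ∷_) (map-applyUpTo F (t ∘ suc) n)

  ∑-applyUpTo≈conv : ∀ (f g : ℕ → Carrier) n →
                     foldr _+_ 0# (applyUpTo (λ i → f i * g (n ∸ i)) (suc n)) ≈ conv f g n
  ∑-applyUpTo≈conv f g zero    = +-identityʳ _
  ∑-applyUpTo≈conv f g (suc n) = +-congˡ (∑-applyUpTo≈conv (f ∘ suc) g n)

  ∑-upTo≈conv : ∀ (f g : ℕ → Carrier) n → ∑[ i ∈ upTo (suc n) ] (f i * g (n ∸ i)) ≈ conv f g n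
  ∑-upTo≈conv f g n = trans (reflexive (≡.cong (foldr _+_ 0#) (map-applyUpTo _ (λ i → i) (suc n))))
                            (∑-applyUpTo≈conv f g n)

  conv-cong : ∀ {f f′ g g′ : ℕ → Carrier} → (∀ i → f i ≈ f′ i) → (∀ i → g i ≈ g′ i) →
              ∀ n → conv f g n ≈ conv f′ g′ n
  conv-cong f≈ g≈ zero    = *-cong (f≈ 0) (g≈ 0)
  conv-cong f≈ g≈ (suc n) = +-cong (*-cong (f≈ 0) (g≈ (suc n))) (conv-cong (f≈ ∘ suc) g≈ n)

  conv-+ˡ : ∀ (f f′ g : ℕ → Carrier) n → conv (λ i → f i + f′ i) g n ≈ conv f g n + conv f′ g n
  conv-+ˡ f f′ g zero    = distribʳ _ _ _
  conv-+ˡ f f′ g (suc n) =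
    trans (+-cong (distribʳ _ _ _) (conv-+ˡ (f ∘ suc) (f′ ∘ suc) g n)) (interchange _ _ _ _)

  conv-*ˡ : ∀ (x : Carrier) (f g : ℕ → Carrier) n → conv (λ i → x * f i) g n ≈ x * conv f g n
  conv-*ˡ x f g zero    = *-assoc _ _ _
  conv-*ˡ x f g (suc n) = trans (+-cong (*-assoc _ _ _) (conv-*ˡ x (f ∘ suc) g n)) (sym (distribˡ x _ _))

  conv-∑-steps : ∀ (x : Step → Carrier) (f : Step → ℕ → Carrier) g n →
                 conv (λ i → ∑-steps (λ s → x s * f s i)) g n ≈ ∑-steps (λ s → x s * conv (f s) g n)
  conv-∑-steps x f g n =
    trans (conv-+ˡ _ _ g n)
          (+-cong (conv-*ˡ (x down) (f down) g n)
                  (trans (conv-+ˡ _ _ g n) (+-cong (conv-*ˡ (x stay) (f stay) g n) (conv-*ˡ (x up) (f up) g n))))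

  conv-constantˡ : ∀ (f g : ℕ → Carrier) → (∀ i → f (suc i) ≈ 0#) → ∀ n → conv f g n ≈ f 0 * g n
  conv-constantˡ f g f≈0 zero    = refl
  conv-constantˡ f g f≈0 (suc n) =
    trans (+-congˡ (trans (conv-constantˡ (f ∘ suc) g (f≈0 ∘ suc) n) (trans (*-congʳ (f≈0 0)) (zeroˡ _))))
          (+-identityʳ _)

  conv-zeroˡ : ∀ (f g : ℕ → Carrier) → (∀ i → f i ≈ 0#) → ∀ n → conv f g n ≈ 0#
  conv-zeroˡ f g f≈0 n = trans (conv-constantˡ f g (f≈0 ∘ suc) n) (trans (*-congʳ (f≈0 0)) (zeroˡ _))

  conv-shiftˡ : ∀ (f g : ℕ → Carrier) → f 0 ≈ 0# → ∀ n → conv f g (suc n) ≈ conv (f ∘ suc) g n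
  conv-shiftˡ f g f0≈0 n = trans (+-congʳ (trans (*-congʳ f0≈0) (zeroˡ _))) (+-identityˡ _)

  conv-linearʳ : ∀ (f h : ℕ → Carrier) → h 0 ≈ 0# → (∀ i → h (suc (suc i)) ≈ 0#) →
                 ∀ m → conv f h (suc m) ≈ f m * h 1
  conv-linearʳ f h h0≈0 h≈0 zero    = trans (+-congˡ (trans (*-congˡ h0≈0) (zeroʳ _))) (+-identityʳ _)
  conv-linearʳ f h h0≈0 h≈0 (suc m) =
    trans (+-cong (trans (*-congˡ (h≈0 m)) (zeroʳ _)) (conv-linearʳ (f ∘ suc) h h0≈0 h≈0 m)) (+-identityˡ _)

module WeightedWalks {c ℓ} (Λ : Ring c ℓ) where
  open Ring Λ
  open Sums Λ
  open import Relation.Binary.Reasoning.Setoid setoid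
  open import Algebra.Bundles using (AbelianGroup)
  open import Algebra.Properties.Group (AbelianGroup.group ℤ.+-0-abelianGroup)
    using (∙-cancelʳ; //-rightDividesʳ)
  open import Algebra.Properties.CommutativeSemigroup ℤ.+-commutativeSemigroup using (xy∙z≈xz∙y)

  Weights : Set c
  Weights = ℤ → Step → Carrier

  weight : Weights → ∀ {l} → ℤ → Vec Step l → Carrier
  weight V a []       = 1#
  weight V a (s ∷ ss) = V a s * weight V (a ℤ.+ δ s) ss

  -- A walk of positive length is standard iff its first position lies above
  -- its endpoint and its tail is standard; this gives the first-step recursion.
  paths : Weights → ℕ → ℤ → ℤ → Carrier
  paths V zero    a b = iverson (a ℤ.≟ b) 1#
  paths V (suc l) a b = iverson (b ℤ.≤? a) (∑-steps (λ s → V a s * paths V l (a ℤ.+ δ s) b))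

  module _ (V : Weights) (b : ℤ) where

    stdWeight : ∀ {l} → ℤ → Vec Step l → Carrier
    stdWeight a ss = iverson (stdWalk? a b ss) (weight V a ss)

    stdWeight-∷ : ∀ {l} a s (ss : Vec Step l) → b ℤ.≤ a →
                  stdWeight a (s ∷ ss) ≈ V a s * stdWeight (a ℤ.+ δ s) ss
    stdWeight-∷ a s ss b≤a = begin
      iverson (stdWalk? a b (s ∷ ss)) (V a s * weight V (a ℤ.+ δ s) ss)
        ≡⟨ iverson-⇔ (λ { (_ ∷ std , end) → std , end })
                     (λ { (std , end) → ℤ.≤-trans (ℤ.≤-reflexive end) b≤a ∷ std , end })
                     (stdWalk? a b (s ∷ ss)) (stdWalk? (a ℤ.+ δ s) b ss) _ ⟩
      iverson (stdWalk? (a ℤ.+ δ s) b ss) (V a s * weight V (a ℤ.+ δ s) ss)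
        ≈⟨ iverson-*ˡ (stdWalk? (a ℤ.+ δ s) b ss) _ _ ⟨
      V a s * stdWeight (a ℤ.+ δ s) ss ∎

    stdWeight-∷-below : ∀ {l} a s (ss : Vec Step l) → ¬ b ℤ.≤ a → stdWeight a (s ∷ ss) ≡ 0#
    stdWeight-∷-below a s ss b≰a =
      iverson-no (λ { (e≤a ∷ _ , end) → b≰a (ℤ.≤-trans (ℤ.≤-reflexive (≡.sym end)) e≤a) })
                 (stdWalk? a b (s ∷ ss)) _

    ∑-allSteps≈paths : ∀ l a → ∑ (allSteps l) (stdWeight a) ≈ paths V l a b
    ∑-allSteps≈paths zero a = trans (+-identityʳ _) (reflexive
      (iverson-⇔ (λ { (_ , end) → end }) (λ { end → (ℤ.≤-refl ∷ []) , end })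
                 (stdWalk? a b []) (a ℤ.≟ b) 1#))
    ∑-allSteps≈paths (suc l) a with b ℤ.≤? a
    ... | yes b≤a = begin
      ∑ (allSteps (suc l)) (stdWeight a)
        ≈⟨ ∑-allSteps-suc l (stdWeight a) ⟩
      ∑-steps (λ s → ∑[ ss ∈ allSteps l ] stdWeight a (s ∷ ss))
        ≈⟨ ∑-steps-cong (λ s → ∑-cong (λ ss → stdWeight-∷ a s ss b≤a) (allSteps l)) ⟩
      ∑-steps (λ s → ∑[ ss ∈ allSteps l ] (V a s * stdWeight (a ℤ.+ δ s) ss))
        ≈⟨ ∑-steps-cong {g = λ s → V a s * paths V l (a ℤ.+ δ s) b}
                        (λ s → trans (∑-*ˡ (V a s) _ (allSteps l)) (*-congˡ (∑-allSteps≈paths l _))) ⟩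
      ∑-steps (λ s → V a s * paths V l (a ℤ.+ δ s) b) ∎
    ... | no b≰a = ∑-zero (λ { (s ∷ ss) → reflexive (stdWeight-∷-below a s ss b≰a) }) (allSteps (suc l))

  ∑-stdWalks≈paths : ∀ V l a b → ∑ (stdWalks l a b) (weight V a) ≈ paths V l a b
  ∑-stdWalks≈paths V l a b =
    trans (∑-filter (stdWalk? a b) (weight V a) (allSteps l)) (∑-allSteps≈paths V b l a)

  paths-translate : ∀ V l a b x → paths V l (a ℤ.+ x) (b ℤ.+ x) ≡ paths (λ y → V (y ℤ.+ x)) l a b
  paths-translate V zero a b x =
    iverson-⇔ (∙-cancelʳ x a b) (≡.cong (ℤ._+ x)) (a ℤ.+ x ℤ.≟ b ℤ.+ x) (a ℤ.≟ b) 1#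
  paths-translate V (suc l) a b x = ≡.trans
    (≡.cong (iverson (b ℤ.+ x ℤ.≤? a ℤ.+ x)) (≡.cong₂ _+_ (step down) (≡.cong₂ _+_ (step stay) (step up))))
    (iverson-⇔ (λ le → ≡.subst₂ ℤ._≤_ (//-rightDividesʳ x b) (//-rightDividesʳ x a) (ℤ.+-monoˡ-≤ (ℤ.- x) le))
               (ℤ.+-monoˡ-≤ x) (b ℤ.+ x ℤ.≤? a ℤ.+ x) (b ℤ.≤? a) _)
    where
    step : ∀ s → V (a ℤ.+ x) s * paths V l (a ℤ.+ x ℤ.+ δ s) (b ℤ.+ x)
               ≡ V (a ℤ.+ x) s * paths (λ y → V (y ℤ.+ x)) l (a ℤ.+ δ s) b
    step s = ≡.cong (V (a ℤ.+ x) s *_) (≡.trans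
      (≡.cong (λ y → paths V l y (b ℤ.+ x)) (xy∙z≈xz∙y a x (δ s)))
      (paths-translate V l (a ℤ.+ δ s) b x))

module FirstPassage {c ℓ} (Λ : Ring c ℓ) (A B C D : Ring.Carrier Λ) where
  open Ring Λ
  open Walks Λ A B C D
  open Sums Λ
  open Convolution Λ
  open WeightedWalks Λ
  open import Relation.Binary.Reasoning.Setoid setoid

  w≡weight : ∀ {l} a (ss : Vec Step l) → w ss ≡ weight (λ _ → U) a ss
  w≡weight a []       = ≡.refl
  w≡weight a (s ∷ ss) = ≡.cong (U s *_) (w≡weight (a ℤ.+ δ s) ss)

  w*≡weight : ∀ {l} a (ss : Vec Step l) → w* a ss ≡ weight U* a ss
  w*≡weight a []       = ≡.refl
  w*≡weight a (s ∷ ss) = ≡.cong (U* a s *_) (w*≡weight (a ℤ.+ δ s) ss)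

  G≈paths : ∀ m → G m ≈ paths (λ _ → U) m 0ℤ 0ℤ
  G≈paths m = trans (∑-cong (λ ss → reflexive (w≡weight 0ℤ ss)) (stdWalks m 0ℤ 0ℤ))
                    (∑-stdWalks≈paths (λ _ → U) m 0ℤ 0ℤ)

  u≈paths : ∀ k n → u k n ≈ paths U* n (+ k ℤ.- 1ℤ) 0ℤ
  u≈paths k n = trans (∑-cong (λ ss → reflexive (w*≡weight (+ k ℤ.- 1ℤ) ss)) (stdWalks n (+ k ℤ.- 1ℤ) 0ℤ))
                      (∑-stdWalks≈paths U* n (+ k ℤ.- 1ℤ) 0ℤ)

  U*≡U : ∀ {a} → a ≢ 0ℤ → ∀ s → U* a s ≡ U s
  U*≡U a≢0 down = ≡.refl
  U*≡U {a} a≢0 stay with a ℤ.≟ 0ℤ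
  ... | yes a≡0 = ⊥-elim (a≢0 a≡0)
  ... | no _    = ≡.refl
  U*≡U a≢0 up = ≡.refl

  toOrigin : ℕ → ℤ → Carrier
  toOrigin n a = paths U* n a 0ℤ

  module _ (κ : ℤ) (1≤κ : 1ℤ ℤ.≤ κ) where

    κ≤a⇒0≤a : ∀ {a} → κ ℤ.≤ a → 0ℤ ℤ.≤ a
    κ≤a⇒0≤a κ≤a = ℤ.≤-trans (ℤ.+≤+ ℕ.z≤n) (ℤ.≤-trans 1≤κ κ≤a)

    κ≤a⇒a≢0 : ∀ {a} → κ ℤ.≤ a → a ≢ 0ℤ
    κ≤a⇒a≢0 κ≤a ≡.refl with ℤ.≤-trans 1≤κ κ≤a
    ... | ℤ.+≤+ ()

    κ≤a⇒κ≤a+stay : ∀ {a} → κ ℤ.≤ a → κ ℤ.≤ a ℤ.+ δ stay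
    κ≤a⇒κ≤a+stay {a} κ≤a = ≡.subst (κ ℤ.≤_) (≡.sym (ℤ.+-identityʳ a)) κ≤a

    κ≤a⇒κ≤a+up : ∀ {a} → κ ℤ.≤ a → κ ℤ.≤ a ℤ.+ δ up
    κ≤a⇒κ≤a+up {a} κ≤a = ℤ.≤-trans κ≤a (ℤ.i≤i+j a 1ℤ)

    κ<a⇒κ≤a+down : ∀ {a} → κ ℤ.≤ a → a ≢ κ → κ ℤ.≤ a ℤ.+ δ down
    κ<a⇒κ≤a+down {a} κ≤a a≢κ =
      ≡.subst (κ ℤ.≤_) (ℤ.+-comm ℤ.-1ℤ a) (ℤ.i<j⇒i≤pred[j] (ℤ.≤∧≢⇒< κ≤a (a≢κ ∘ ≡.sym)))

    κ≰κ+down : ¬ κ ℤ.≤ κ ℤ.+ δ down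
    κ≰κ+down le = ℤ.<-irrefl ≡.refl (ℤ.i≤pred[j]⇒i<j (≡.subst (κ ℤ.≤_) (ℤ.+-comm κ ℤ.-1ℤ) le))

    toLevel : ℕ → ℤ → Carrier
    toLevel i a = paths (λ _ → U) i a κ

    -- Coefficient i + 1: standard walks of length i from a to κ, followed by
    -- the first step down to κ - 1.
    firstPassage : ℤ → ℕ → Carrier
    firstPassage a zero    = 0#
    firstPassage a (suc i) = toLevel i a * A

    immediateDrop : ℤ → ℕ → Carrier
    immediateDrop a zero    = iverson (a ℤ.≟ κ) A
    immediateDrop a (suc i) = 0#

    toOrigin-suc : ∀ n {a} → κ ℤ.≤ a → toOrigin (suc n) a ≈ ∑-steps (λ s → U s * toOrigin n (a ℤ.+ δ s))
    toOrigin-suc n {a} κ≤a = trans (reflexive (iverson-yes (κ≤a⇒0≤a κ≤a) (0ℤ ℤ.≤? a) _))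
      (∑-steps-cong {g = λ s → U s * toOrigin n (a ℤ.+ δ s)}
                    (λ s → *-congʳ (reflexive (U*≡U (κ≤a⇒a≢0 κ≤a) s))))

    firstPassage-below : ∀ i → firstPassage (κ ℤ.+ δ down) i ≈ 0#
    firstPassage-below zero          = refl
    firstPassage-below (suc zero)    =
      trans (*-congʳ (reflexive (iverson-no (κ≰κ+down ∘ ℤ.≤-reflexive ∘ ≡.sym) (κ ℤ.+ δ down ℤ.≟ κ) 1#)))
            (zeroˡ A)
    firstPassage-below (suc (suc i)) =
      trans (*-congʳ (reflexive (iverson-no κ≰κ+down (κ ℤ.≤? κ ℤ.+ δ down) _))) (zeroˡ A)

    firstPassage-suc : ∀ {a} → κ ℤ.≤ a → ∀ i →
      firstPassage a (suc i) ≈ immediateDrop a i + ∑-steps (λ s → U s * firstPassage (a ℤ.+ δ s) i)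
    firstPassage-suc {a} κ≤a zero = begin
      iverson (a ℤ.≟ κ) 1# * A     ≈⟨ iverson-*ʳ (a ℤ.≟ κ) 1# A ⟩
      iverson (a ℤ.≟ κ) (1# * A)   ≈⟨ iverson-cong (a ℤ.≟ κ) (*-identityˡ A) ⟩
      iverson (a ℤ.≟ κ) A          ≈⟨ +-identityʳ _ ⟨
      iverson (a ℤ.≟ κ) A + 0#     ≈⟨ +-congˡ (∑-steps-zero {f = λ s → U s * 0#} (zeroʳ ∘ U)) ⟨
      immediateDrop a 0 + ∑-steps (λ s → U s * 0#) ∎
    firstPassage-suc {a} κ≤a (suc i) = begin
      iverson (κ ℤ.≤? a) (∑-steps (λ s → U s * toLevel i (a ℤ.+ δ s))) * A
        ≡⟨ ≡.cong (_* A) (iverson-yes κ≤a (κ ℤ.≤? a) _) ⟩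
      ∑-steps (λ s → U s * toLevel i (a ℤ.+ δ s)) * A
        ≈⟨ trans (∑-steps-*ʳ (λ s → U s * toLevel i (a ℤ.+ δ s)) A) (∑-steps-cong {g = λ s → U s * firstPassage (a ℤ.+ δ s) (suc i)}
                                                (λ s → *-assoc (U s) _ A)) ⟩
      ∑-steps (λ s → U s * firstPassage (a ℤ.+ δ s) (suc i))
        ≈⟨ +-identityˡ _ ⟨
      0# + ∑-steps (λ s → U s * firstPassage (a ℤ.+ δ s) (suc i)) ∎

    toOrigin≈conv : ∀ n {a} → κ ℤ.≤ a →
      toOrigin n a ≈ conv (firstPassage a) (λ j → toOrigin j (κ ℤ.+ δ down)) n
    toOrigin≈conv zero {a} κ≤a =
      trans (reflexive (iverson-no (κ≤a⇒a≢0 κ≤a) (a ℤ.≟ 0ℤ) 1#)) (sym (zeroˡ _))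
    toOrigin≈conv (suc n) {a} κ≤a = begin
      toOrigin (suc n) a
        ≈⟨ toOrigin-suc n κ≤a ⟩
      A * toOrigin n (a ℤ.+ δ down) + (B * toOrigin n (a ℤ.+ δ stay) + C * toOrigin n (a ℤ.+ δ up))
        ≈⟨ +-cong (downStep (a ℤ.≟ κ))
                  (+-cong (*-congˡ (toOrigin≈conv n (κ≤a⇒κ≤a+stay κ≤a)))
                          (*-congˡ (toOrigin≈conv n (κ≤a⇒κ≤a+up κ≤a)))) ⟩
      (conv (immediateDrop a) g n + A * conv (firstPassage (a ℤ.+ δ down)) g n)
        + (B * conv (firstPassage (a ℤ.+ δ stay)) g n + C * conv (firstPassage (a ℤ.+ δ up)) g n)
        ≈⟨ +-assoc _ _ _ ⟩
      conv (immediateDrop a) g n + ∑-steps (λ s → U s * conv (firstPassage (a ℤ.+ δ s)) g n)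
        ≈⟨ trans (conv-+ˡ _ _ g n) (+-congˡ (conv-∑-steps U (λ s → firstPassage (a ℤ.+ δ s)) g n)) ⟨
      conv (λ i → immediateDrop a i + ∑-steps (λ s → U s * firstPassage (a ℤ.+ δ s) i)) g n
        ≈⟨ conv-cong (λ i → sym (firstPassage-suc κ≤a i)) (λ _ → refl) n ⟩
      conv (firstPassage a ∘ suc) g n
        ≈⟨ conv-shiftˡ (firstPassage a) g refl n ⟨
      conv (firstPassage a) g (suc n) ∎
      where
      g : ℕ → Carrier
      g j = toOrigin j (κ ℤ.+ δ down)

      -- From a = κ the down-step is the first passage itself; otherwise the
      -- walk is still above the level and the induction hypothesis applies.
      downStep : Dec (a ≡ κ) →
                 A * toOrigin n (a ℤ.+ δ down) ≈ conv (immediateDrop a) g n + A * conv (firstPassage (a ℤ.+ δ down)) g n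
      downStep (yes ≡.refl) = begin
        A * g n
          ≈⟨ +-identityʳ _ ⟨
        A * g n + 0#
          ≈⟨ +-cong (*-congʳ (reflexive (≡.sym (iverson-yes ≡.refl (a ℤ.≟ κ) A))))
                    (sym (trans (*-congˡ (conv-zeroˡ _ g firstPassage-below n)) (zeroʳ A))) ⟩
        immediateDrop a 0 * g n + A * conv (firstPassage (a ℤ.+ δ down)) g n
          ≈⟨ +-congʳ (conv-constantˡ (immediateDrop a) g (λ _ → refl) n) ⟨
        conv (immediateDrop a) g n + A * conv (firstPassage (a ℤ.+ δ down)) g n ∎
      downStep (no a≢κ) = begin
        A * toOrigin n (a ℤ.+ δ down)
          ≈⟨ *-congˡ (toOrigin≈conv n (κ<a⇒κ≤a+down κ≤a a≢κ)) ⟩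
        A * conv (firstPassage (a ℤ.+ δ down)) g n
          ≈⟨ +-identityˡ _ ⟨
        0# + A * conv (firstPassage (a ℤ.+ δ down)) g n
          ≈⟨ +-congʳ (trans (conv-constantˡ (immediateDrop a) g (λ _ → refl) n)
                            (trans (*-congʳ (reflexive (iverson-no a≢κ (a ℤ.≟ κ) A))) (zeroˡ _))) ⟨
        conv (immediateDrop a) g n + A * conv (firstPassage (a ℤ.+ δ down)) g n ∎

    G⊛Az≈firstPassage : ∀ i → (G ⊛ Az) i ≈ firstPassage κ i
    G⊛Az≈firstPassage zero    = trans (∑-upTo≈conv G Az 0) (zeroʳ _)
    G⊛Az≈firstPassage (suc m) = begin
      (G ⊛ Az) (suc m)                         ≈⟨ ∑-upTo≈conv G Az (suc m) ⟩
      conv G Az (suc m)                        ≈⟨ conv-linearʳ G Az refl (λ _ → refl) m ⟩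
      G m * A                                  ≈⟨ *-congʳ (G≈paths m) ⟩
      paths (λ _ → U) m 0ℤ 0ℤ * A              ≡⟨ ≡.cong (_* A) translate ⟨
      toLevel m κ * A                          ∎
      where
      translate : toLevel m κ ≡ paths (λ _ → U) m 0ℤ 0ℤ
      translate = ≡.trans (≡.cong (λ y → paths (λ _ → U) m y y) (≡.sym (ℤ.+-identityˡ κ)))
                          (paths-translate (λ _ → U) m 0ℤ 0ℤ κ)

lemma5p3 : ∀ {c ℓ : Level} (Λ : Ring c ℓ) (A B C D : Ring.Carrier Λ) (k : ℕ) → 1 ≤ k →
    ∀ (n : ℕ) → Ring._≈_ Λ (Walks.uSeries Λ A B C D (suc k) n)
      (Walks._⊛_ Λ A B C D (Walks._⊛_ Λ A B C D (Walks.G Λ A B C D) (Walks.Az Λ A B C D)) (Walks.uSeries Λ A B C D k) n)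
lemma5p3 Λ A B C D k 1≤k n = begin
  u (suc k) n                                                       ≈⟨ u≈paths (suc k) n ⟩
  toOrigin n (+ k)                                                  ≈⟨ toOrigin≈conv κ 1≤κ n ℤ.≤-refl ⟩
  conv (firstPassage κ 1≤κ κ) (λ j → toOrigin j (κ ℤ.+ δ down)) n   ≈⟨ conv-cong (G⊛Az≈firstPassage κ 1≤κ) (u≈paths k) n ⟨
  conv (G ⊛ Az) (uSeries k) n                                       ≈⟨ ∑-upTo≈conv (G ⊛ Az) (uSeries k) n ⟨
  ((G ⊛ Az) ⊛ uSeries k) n                                          ∎
  where
  open Ring Λ
  open Walks Λ A B C D
  open Convolution Λ
  open FirstPassage Λ A B C D
  open import Relation.Binary.Reasoning.Setoid setoid
  κ : ℤ
  κ = + k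
  1≤κ : 1ℤ ℤ.≤ κ
  1≤κ = ℤ.+≤+ 1≤k
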